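{- For every integer $n\geqslant 7$, $\pi_{T}(C_n^2)=\lceil n/2\rceil$, where $C_n^2$ is the square of the cycle $C_n$ of length $n$.
   Context: All graphs are simple. $C_n=v_0v_1\cdots v_{n-1}v_0$ denotes the cycle of length $n$. For a connected graph $G$, its square $G^2$ has vertex set $V(G)$, and two distinct vertices are adjacent in $G^2$ if and only if their distance in $G$ is at most $2$. For a graph $G$, $\pi_{T}(G)$ denotes the minimum number of edges whose deletion from $G$ yields a triangle-free graph (no subgraph isomorphic to $K_3$). -}

module Defs where

open import Data.Nat using (ℕ; suc)
open import Data.Fin using (Fin; toℕ)
open import Data.Product using (_×_; ∃; _,_)
open import Data.Sum using (_⊎_)
open import Data.List using (List)
open import Data.List.Relation.Unary.All using (All)
open import Data.List.Relation.Unary.AllPairs using (AllPairs)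
open import Data.List.Membership.Propositional using (_∈_)
open import Relation.Nullary using (¬_)
open import Relation.Binary.PropositionalEquality using (_≡_; _≢_)

Graph : ℕ → Set₁
Graph n = Fin n → Fin n → Set

Cycle : (n : ℕ) → Graph n
Cycle n i j =
  (toℕ j ≡ suc (toℕ i)) ⊎ (toℕ i ≡ suc (toℕ j)) ⊎
  ((toℕ i ≡ 0 × suc (toℕ j) ≡ n) ⊎ (toℕ j ≡ 0 × suc (toℕ i) ≡ n))

Square : {n : ℕ} → Graph n → Graph n
Square G u v = u ≢ v × (G u v ⊎ ∃ λ w → G u w × G w v)

-- An unordered edge is represented by an ordered pair.
Edge : ℕ → Set
Edge n = Fin n × Fin n

SameEdge : {n : ℕ} → Edge n → Edge n → Set
SameEdge (a , b) (c , d) = (a ≡ c × b ≡ d) ⊎ (a ≡ d × b ≡ c)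

-- F is (a listing of) a set of edges of G: every entry is an edge of G,
-- and no unordered edge is listed twice.  Its size is its length.
IsEdgeSet : {n : ℕ} → Graph n → List (Edge n) → Set
IsEdgeSet G F = All (λ e → G (Data.Product.proj₁ e) (Data.Product.proj₂ e)) F
              × AllPairs (λ e f → ¬ SameEdge e f) F

DeleteEdges : {n : ℕ} → Graph n → List (Edge n) → Graph n
DeleteEdges G F u v = G u v × ¬ ((u , v) ∈ F) × ¬ ((v , u) ∈ F)

TriangleFree : {n : ℕ} → Graph n → Set
TriangleFree G = ∀ a b c → ¬ (G a b × G b c × G a c)

PiT≡ : {n : ℕ} → Graph n → ℕ → Set
PiT≡ G m =
  (∃ λ F → IsEdgeSet G F × Data.List.length F ≡ m × TriangleFree (DeleteEdges G F))
  × (∀ F → IsEdgeSet G F → TriangleFree (DeleteEdges G F) → m Data.Nat.≤ Data.List.length F)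

module Submission where

-- The triangles of C_n² are the n triples {i, i+1, i+2}: orient each edge of a triangle
-- forwards (by 1 or 2 steps); a directed 3-cycle would wind around by 3 to 6 < n steps, so
-- there is a source i and the other two vertices are i+1 and i+2.  Deleting the ⌈n/2⌉
-- edges {2k, 2k+1} meets every such triple.  Conversely an edge lies in at most two of
-- these triangles ({i-1, i, i+1} and {i, i+1, i+2} for the edge {i, i+1}) and passes
-- through the first vertex of at most one of them; so mapping each triangle to an edge of
-- F it contains, together with that bit, is injective and gives n ≤ 2|F|.

open import Data.Nat using (ℕ; zero; suc; _+_; _*_; _∸_; _≤_; _<_; z≤n; s≤s; NonZero; pred; _%_; _/_; _<?_; ⌈_/2⌉; ⌊_/2⌋; >-nonZero)
open import Data.Nat.Divisibility using (_∣_; divides; ∣⇒≤)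
open import Data.Nat.Properties
open import Data.Nat.DivMod using (m%n<n; m<n⇒m%n≡m; %-distribˡ-+; m%n%n≡m%n; [m+n]%n≡m%n; n%n≡0; m≡m%n+[m/n]*n)
open import Data.Fin using (Fin; toℕ; fromℕ<; combine)
open import Data.Fin.Properties using (toℕ-fromℕ<; toℕ-injective; toℕ<n; combine-injective; injective⇒≤)
import Data.Fin as Fin
open import Data.List using (List; []; _∷_; length; tabulate; lookup)
open import Data.List.Properties using (length-tabulate)
open import Data.List.Membership.Propositional using (_∈_)
open import Data.List.Membership.Propositional.Properties using (∈-tabulate⁺)
open import Data.List.Relation.Unary.Any using (here; there; index)
open import Data.List.Relation.Unary.Any.Properties using (lookup-index)
import Data.List.Relation.Unary.All.Properties as All
import Data.List.Relation.Unary.AllPairs.Properties as AllPairs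
open import Data.Product using (_×_; _,_; ∃-syntax; proj₁; proj₂)
open import Data.Product.Properties using (≡-dec)
open import Data.Sum using (_⊎_; inj₁; inj₂)
open import Data.Empty using (⊥-elim)
open import Relation.Nullary using (¬_; Dec; yes; no; _⊎-dec_)
open import Relation.Binary.Definitions using (Symmetric)
open import Relation.Binary.PropositionalEquality
open import Defs

n≤m+m⇒⌈n/2⌉≤m : ∀ {n m} → n ≤ m + m → ⌈ n /2⌉ ≤ m
n≤m+m⇒⌈n/2⌉≤m {n} {m} n≤m+m = subst (⌈ n /2⌉ ≤_) (sym (n≡⌈n+n/2⌉ m)) (⌈n/2⌉-mono n≤m+m)

m+m<n⇒m<⌈n/2⌉ : ∀ {m n} → m + m < n → m < ⌈ n /2⌉
m+m<n⇒m<⌈n/2⌉ {m} {n} m+m<n = subst (_≤ ⌈ n /2⌉) (cong suc (sym (n≡⌊n+n/2⌋ m))) (⌈n/2⌉-mono m+m<n)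

m<⌈n/2⌉⇒m+m<n : ∀ {m n} → m < ⌈ n /2⌉ → m + m < n
m<⌈n/2⌉⇒m+m<n {m} {n} m<⌈n/2⌉ = ≰⇒> λ n≤m+m → <⇒≱ m<⌈n/2⌉ (n≤m+m⇒⌈n/2⌉≤m n≤m+m)

m+m≡n+n⇒m≡n : ∀ {m n} → m + m ≡ n + n → m ≡ n
m+m≡n+n⇒m≡n {m} {n} eq = trans (n≡⌊n+n/2⌋ m) (trans (cong ⌊_/2⌋ eq) (sym (n≡⌊n+n/2⌋ n)))

even-or-odd : ∀ m → ∃[ k ] (m ≡ k + k ⊎ m ≡ suc (k + k))
even-or-odd zero = zero , inj₁ refl
even-or-odd (suc m) with even-or-odd m
... | k , inj₁ m≡2k  = k , inj₂ (cong suc m≡2k)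
... | k , inj₂ m≡2k+1 = suc k , inj₁ (trans (cong suc m≡2k+1) (cong suc (sym (+-suc k k))))

[m+n%d]%d≡[m+n]%d : ∀ m n d .{{_ : NonZero d}} → (m + n % d) % d ≡ (m + n) % d
[m+n%d]%d≡[m+n]%d m n d = begin
  (m + n % d) % d          ≡⟨ %-distribˡ-+ m (n % d) d ⟩
  (m % d + n % d % d) % d  ≡⟨ cong (λ r → (m % d + r) % d) (m%n%n≡m%n n d) ⟩
  (m % d + n % d) % d      ≡⟨ sym (%-distribˡ-+ m n d) ⟩
  (m + n) % d              ∎
  where open ≡-Reasoning

n∣m∧m<n⇒m≡0 : ∀ {m n} → n ∣ m → m < n → m ≡ 0
n∣m∧m<n⇒m≡0 {zero}  _   _   = refl
n∣m∧m<n⇒m≡0 {suc m} n∣m m<n = ⊥-elim (<⇒≱ m<n (∣⇒≤ n∣m))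

module _ {A : Set} (R : A → A → Set) (R-sym : Symmetric R) {a b c : A}
         (ab : R a b) (bc : R b c) (ac : R a c) where

  triangle-edge : ∀ {x y} → x ∈ a ∷ b ∷ c ∷ [] → y ∈ a ∷ b ∷ c ∷ [] → x ≢ y → R x y
  triangle-edge (here refl)                 (here refl)                 x≢y = ⊥-elim (x≢y refl)
  triangle-edge (here refl)                 (there (here refl))         _   = ab
  triangle-edge (here refl)                 (there (there (here refl))) _   = ac
  triangle-edge (there (here refl))         (here refl)                 _   = R-sym ab
  triangle-edge (there (here refl))         (there (here refl))         x≢y = ⊥-elim (x≢y refl)
  triangle-edge (there (here refl))         (there (there (here refl))) _   = bc
  triangle-edge (there (there (here refl))) (here refl)                 _   = R-sym ac
  triangle-edge (there (there (here refl))) (there (here refl))         _   = R-sym bc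
  triangle-edge (there (there (here refl))) (there (there (here refl))) x≢y = ⊥-elim (x≢y refl)

cycle-sym : ∀ {n} → Symmetric (Cycle n)
cycle-sym (inj₁ e)                = inj₂ (inj₁ e)
cycle-sym (inj₂ (inj₁ e))         = inj₁ e
cycle-sym (inj₂ (inj₂ (inj₁ e)))  = inj₂ (inj₂ (inj₂ e))
cycle-sym (inj₂ (inj₂ (inj₂ e)))  = inj₂ (inj₂ (inj₁ e))

square-sym : ∀ {n} {G : Graph n} → Symmetric G → Symmetric (Square G)
square-sym G-sym (u≢v , inj₁ uv)            = ≢-sym u≢v , inj₁ (G-sym uv)
square-sym G-sym (u≢v , inj₂ (w , uw , wv)) = ≢-sym u≢v , inj₂ (w , G-sym wv , G-sym uw)

deleteEdges-sym : ∀ {n} {G : Graph n} (F : List (Edge n)) → Symmetric G → Symmetric (DeleteEdges G F)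
deleteEdges-sym F G-sym (uv , uv∉F , vu∉F) = G-sym uv , vu∉F , uv∉F

module Rotation (n : ℕ) .{{_ : NonZero n}} where

  next : Fin n → Fin n
  next x = fromℕ< (m%n<n (suc (toℕ x)) n)

  shift : ℕ → Fin n → Fin n
  shift zero    x = x
  shift (suc k) x = next (shift k x)

  toℕ-next : ∀ x → toℕ (next x) ≡ suc (toℕ x) % n
  toℕ-next x = toℕ-fromℕ< (m%n<n (suc (toℕ x)) n)

  toℕ-shift : ∀ k x → toℕ (shift k x) ≡ (k + toℕ x) % n
  toℕ-shift zero    x = sym (m<n⇒m%n≡m (toℕ<n x))
  toℕ-shift (suc k) x = begin
    toℕ (next (shift k x))      ≡⟨ toℕ-next (shift k x) ⟩
    (1 + toℕ (shift k x)) % n   ≡⟨ cong (λ r → (1 + r) % n) (toℕ-shift k x) ⟩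
    (1 + (k + toℕ x) % n) % n   ≡⟨ [m+n%d]%d≡[m+n]%d 1 (k + toℕ x) n ⟩
    (suc k + toℕ x) % n         ∎
    where open ≡-Reasoning

  shift-+ : ∀ p q x → shift p (shift q x) ≡ shift (p + q) x
  shift-+ zero    q x = refl
  shift-+ (suc p) q x = cong next (shift-+ p q x)

  shift-period : ∀ x → shift n x ≡ x
  shift-period x = toℕ-injective (begin
    toℕ (shift n x)  ≡⟨ toℕ-shift n x ⟩
    (n + toℕ x) % n  ≡⟨ cong (_% n) (+-comm n (toℕ x)) ⟩
    (toℕ x + n) % n  ≡⟨ [m+n]%n≡m%n (toℕ x) n ⟩
    toℕ x % n        ≡⟨ m<n⇒m%n≡m (toℕ<n x) ⟩
    toℕ x            ∎)
    where open ≡-Reasoning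

  shift-pred-next : ∀ x → shift (pred n) (next x) ≡ x
  shift-pred-next x = begin
    shift (pred n) (shift 1 x)  ≡⟨ shift-+ (pred n) 1 x ⟩
    shift (pred n + 1) x        ≡⟨ cong (λ k → shift k x) (trans (+-comm (pred n) 1) (suc-pred n)) ⟩
    shift n x                   ≡⟨ shift-period x ⟩
    x                           ∎
    where open ≡-Reasoning

  next-injective : ∀ {x y} → next x ≡ next y → x ≡ y
  next-injective {x} {y} eq =
    trans (sym (shift-pred-next x)) (trans (cong (shift (pred n)) eq) (shift-pred-next y))

  shift-injective : ∀ k {x y} → shift k x ≡ shift k y → x ≡ y
  shift-injective zero    eq = eq
  shift-injective (suc k) eq = shift-injective k (next-injective eq)

  shift-fixed⇒≡0 : ∀ {k x} → shift k x ≡ x → k < n → k ≡ 0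
  shift-fixed⇒≡0 {k} {x} eq k<n = n∣m∧m<n⇒m≡0 (divides q (+-cancelˡ-≡ (toℕ x) k (q * n) (begin
    toℕ x + k                   ≡⟨ +-comm (toℕ x) k ⟩
    k + toℕ x                   ≡⟨ m≡m%n+[m/n]*n (k + toℕ x) n ⟩
    (k + toℕ x) % n + q * n     ≡⟨ cong (_+ q * n) (trans (sym (toℕ-shift k x)) (cong toℕ eq)) ⟩
    toℕ x + q * n               ∎))) k<n
    where
    open ≡-Reasoning
    q = (k + toℕ x) / n

  private
    shift-cancel-≤ : ∀ {p q x} → p ≤ q → shift p x ≡ shift q x → q < n → p ≡ q
    shift-cancel-≤ {p} {q} {x} p≤q eq q<n = begin
      p            ≡⟨⟩
      0 + p        ≡⟨ cong (_+ p) (sym (shift-fixed⇒≡0 fixed (≤-<-trans (m∸n≤m q p) q<n))) ⟩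
      (q ∸ p) + p  ≡⟨ m∸n+n≡m p≤q ⟩
      q            ∎
      where
      open ≡-Reasoning
      fixed : shift (q ∸ p) (shift p x) ≡ shift p x
      fixed = trans (shift-+ (q ∸ p) p x) (trans (cong (λ k → shift k x) (m∸n+n≡m p≤q)) (sym eq))

  shift-cancel : ∀ {p q x} → shift p x ≡ shift q x → p < n → q < n → p ≡ q
  shift-cancel {p} {q} eq p<n q<n with ≤-total p q
  ... | inj₁ p≤q = shift-cancel-≤ p≤q eq q<n
  ... | inj₂ q≤p = sym (shift-cancel-≤ q≤p (sym eq) p<n)

  toℕ-next-nonlast : ∀ {x} → suc (toℕ x) < n → toℕ (next x) ≡ suc (toℕ x)
  toℕ-next-nonlast {x} x+1<n = trans (toℕ-next x) (m<n⇒m%n≡m x+1<n)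

  toℕ-next-last : ∀ {x} → suc (toℕ x) ≡ n → toℕ (next x) ≡ 0
  toℕ-next-last {x} x+1≡n = trans (toℕ-next x) (trans (cong (_% n) x+1≡n) (n%n≡0 n))

  toℕ-next-cases : ∀ x → toℕ (next x) ≡ suc (toℕ x) ⊎ toℕ (next x) ≡ 0 × suc (toℕ x) ≡ n
  toℕ-next-cases x with suc (toℕ x) <? n
  ... | yes x+1<n = inj₁ (toℕ-next-nonlast x+1<n)
  ... | no  x+1≮n = inj₂ (toℕ-next-last x+1≡n , x+1≡n)
    where
    x+1≡n : suc (toℕ x) ≡ n
    x+1≡n = ≤-antisym (toℕ<n x) (≮⇒≥ x+1≮n)

  cycle-next : ∀ x → Cycle n x (next x)
  cycle-next x with toℕ-next-cases x
  ... | inj₁ nonlast = inj₁ nonlast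
  ... | inj₂ last    = inj₂ (inj₂ (inj₂ last))

  private
    successor : ∀ {u v} → toℕ v ≡ suc (toℕ u) → v ≡ next u
    successor {u} {v} eq = toℕ-injective (trans eq (sym (toℕ-next-nonlast (subst (_< n) eq (toℕ<n v)))))

  cycle⇒next : ∀ {x y} → Cycle n x y → y ≡ next x ⊎ x ≡ next y
  cycle⇒next {x} {y} (inj₁ y≡x+1)                       = inj₁ (successor y≡x+1)
  cycle⇒next {x} {y} (inj₂ (inj₁ x≡y+1))                = inj₂ (successor x≡y+1)
  cycle⇒next {x} {y} (inj₂ (inj₂ (inj₁ (x≡0 , y+1≡n)))) = inj₂ (toℕ-injective (trans x≡0 (sym (toℕ-next-last y+1≡n))))
  cycle⇒next {x} {y} (inj₂ (inj₂ (inj₂ (y≡0 , x+1≡n)))) = inj₁ (toℕ-injective (trans y≡0 (sym (toℕ-next-last x+1≡n))))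

module SquareOfCycle (n : ℕ) (7≤n : 7 ≤ n) where

  private instance
    n≢0 : NonZero n
    n≢0 = >-nonZero (≤-trans (s≤s z≤n) 7≤n)

  open Rotation n

  C² : Graph n
  C² = Square (Cycle n)

  ≤6⇒<n : ∀ {k} → k ≤ 6 → k < n
  ≤6⇒<n k≤6 = <-≤-trans (s≤s k≤6) 7≤n

  x≢next-x : ∀ x → x ≢ next x
  x≢next-x x x≡next-x = 1+n≢0 (shift-fixed⇒≡0 (sym x≡next-x) (≤6⇒<n (s≤s z≤n)))

  x≢next²-x : ∀ x → x ≢ next (next x)
  x≢next²-x x x≡next²-x = 1+n≢0 (shift-fixed⇒≡0 (sym x≡next²-x) (≤6⇒<n (s≤s (s≤s z≤n))))

  C²-next : ∀ x → C² x (next x)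
  C²-next x = x≢next-x x , inj₁ (cycle-next x)

  C²-next² : ∀ x → C² x (next (next x))
  C²-next² x = x≢next²-x x , inj₂ (next x , cycle-next x , cycle-next (next x))

  Ahead : Fin n → Fin n → Set
  Ahead x y = ∃[ k ] 1 ≤ k × k ≤ 2 × y ≡ shift k x

  C²⇒ahead : ∀ {x y} → C² x y → Ahead x y ⊎ Ahead y x
  C²⇒ahead (_ , inj₁ xy) with cycle⇒next xy
  ... | inj₁ y≡next-x = inj₁ (1 , ≤-refl , s≤s z≤n , y≡next-x)
  ... | inj₂ x≡next-y = inj₂ (1 , ≤-refl , s≤s z≤n , x≡next-y)
  C²⇒ahead (x≢y , inj₂ (w , xw , wy)) with cycle⇒next xw | cycle⇒next wy
  ... | inj₁ refl | inj₁ refl = inj₁ (2 , s≤s z≤n , ≤-refl , refl)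
  ... | inj₁ refl | inj₂ eq   = ⊥-elim (x≢y (next-injective eq))
  ... | inj₂ refl | inj₁ refl = ⊥-elim (x≢y refl)
  ... | inj₂ refl | inj₂ refl = inj₂ (2 , s≤s z≤n , ≤-refl , refl)

  ahead-acyclic : ∀ {a b c} → Ahead a b → Ahead b c → ¬ Ahead c a
  ahead-acyclic {a} (p , _ , p≤2 , refl) (q , _ , q≤2 , refl) (suc r , _ , r+1≤2 , a≡) =
    1+n≢0 (shift-fixed⇒≡0 around (≤6⇒<n (+-mono-≤ r+1≤2 (+-mono-≤ q≤2 p≤2))))
    where
    open ≡-Reasoning
    around : shift (suc r + (q + p)) a ≡ a
    around = begin
      shift (suc r + (q + p)) a           ≡⟨ sym (shift-+ (suc r) (q + p) a) ⟩
      shift (suc r) (shift (q + p) a)     ≡⟨ cong (shift (suc r)) (sym (shift-+ q p a)) ⟩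
      shift (suc r) (shift q (shift p a)) ≡⟨ sym a≡ ⟩
      a                                   ∎

  private
    1+q+1+p≤2 : ∀ {p q} → suc q + suc p ≤ 2 → p ≡ 0 × q ≡ 0
    1+q+1+p≤2 {zero}  {zero}  _                 = refl , refl
    1+q+1+p≤2 {suc p} {zero}  (s≤s (s≤s ()))
    1+q+1+p≤2 {p}     {suc q} (s≤s (s≤s q+1+p≤0)) with () ← m+n≤o⇒n≤o q q+1+p≤0

  ahead-path : ∀ {a b c} → Ahead a b → Ahead b c → Ahead a c → b ≡ next a × c ≡ next (next a)
  ahead-path {a} (suc p , _ , p+1≤2 , refl) (suc q , _ , q+1≤2 , refl) (r , _ , r≤2 , c≡)
    with 1+q+1+p≤2 (subst (_≤ 2) (sym q+p≡r) r≤2)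
    where
    q+p≡r : suc q + suc p ≡ r
    q+p≡r = shift-cancel (trans (sym (shift-+ (suc q) (suc p) a)) c≡)
              (≤6⇒<n (+-mono-≤ q+1≤2 (≤-trans p+1≤2 (m≤m+n 2 2))))
              (≤6⇒<n (≤-trans r≤2 (m≤m+n 2 4)))
  ... | refl , refl = refl , refl

  Consecutive : List (Fin n) → Set
  Consecutive vs = ∃[ i ] i ∈ vs × next i ∈ vs × next (next i) ∈ vs

  private
    1st : ∀ {x y z : Fin n} → x ∈ x ∷ y ∷ z ∷ []
    1st = here refl
    2nd : ∀ {x y z : Fin n} → y ∈ x ∷ y ∷ z ∷ []
    2nd = there (here refl)
    3rd : ∀ {x y z : Fin n} → z ∈ x ∷ y ∷ z ∷ []
    3rd = there (there (here refl))

  path⇒consecutive : ∀ {x y z vs} → Ahead x y → Ahead y z → Ahead x z →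
                     x ∈ vs → y ∈ vs → z ∈ vs → Consecutive vs
  path⇒consecutive x→y y→z x→z x∈ y∈ z∈ with ahead-path x→y y→z x→z
  ... | refl , refl = _ , x∈ , y∈ , z∈

  triangle⇒consecutive : ∀ {a b c} → C² a b → C² b c → C² a c → Consecutive (a ∷ b ∷ c ∷ [])
  triangle⇒consecutive ab bc ac with C²⇒ahead ab | C²⇒ahead bc | C²⇒ahead ac
  ... | inj₁ a→b | inj₁ b→c | inj₁ a→c = path⇒consecutive a→b b→c a→c 1st 2nd 3rd
  ... | inj₁ a→b | inj₁ b→c | inj₂ c→a = ⊥-elim (ahead-acyclic a→b b→c c→a)
  ... | inj₁ a→b | inj₂ c→b | inj₁ a→c = path⇒consecutive a→c c→b a→b 1st 3rd 2nd
  ... | inj₁ a→b | inj₂ c→b | inj₂ c→a = path⇒consecutive c→a a→b c→b 3rd 1st 2nd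
  ... | inj₂ b→a | inj₁ b→c | inj₁ a→c = path⇒consecutive b→a a→c b→c 2nd 1st 3rd
  ... | inj₂ b→a | inj₁ b→c | inj₂ c→a = path⇒consecutive b→c c→a b→a 2nd 3rd 1st
  ... | inj₂ b→a | inj₂ c→b | inj₁ a→c = ⊥-elim (ahead-acyclic a→c c→b b→a)
  ... | inj₂ b→a | inj₂ c→b | inj₂ c→a = path⇒consecutive c→b b→a c→a 3rd 2nd 1st

  evenVertex : Fin ⌈ n /2⌉ → Fin n
  evenVertex k = fromℕ< (m<⌈n/2⌉⇒m+m<n (toℕ<n k))

  toℕ-evenVertex : ∀ k → toℕ (evenVertex k) ≡ toℕ k + toℕ k
  toℕ-evenVertex k = toℕ-fromℕ< (m<⌈n/2⌉⇒m+m<n (toℕ<n k))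

  matchingEdge : Fin ⌈ n /2⌉ → Edge n
  matchingEdge k = evenVertex k , next (evenVertex k)

  matching : List (Edge n)
  matching = tabulate matchingEdge

  matching-isEdgeSet : IsEdgeSet C² matching
  matching-isEdgeSet = All.tabulate⁺ (λ k → C²-next (evenVertex k)) , AllPairs.tabulate⁺ distinct
    where
    distinct : ∀ {k l} → k ≢ l → ¬ SameEdge (matchingEdge k) (matchingEdge l)
    distinct {k} {l} k≢l (inj₁ (same-start , _)) = k≢l (toℕ-injective (m+m≡n+n⇒m≡n
      (trans (sym (toℕ-evenVertex k)) (trans (cong toℕ same-start) (toℕ-evenVertex l)))))
    distinct {k} _ (inj₂ (u≡next-v , next-u≡v)) =
      x≢next²-x (evenVertex k) (trans u≡next-v (cong next (sym next-u≡v)))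

  even⇒matched : ∀ {x} k → toℕ x ≡ k + k → (x , next x) ∈ matching
  even⇒matched {x} k x≡2k = subst (λ v → (v , next v) ∈ matching) vertex≡x (∈-tabulate⁺ k′)
    where
    k′ : Fin ⌈ n /2⌉
    k′ = fromℕ< (m+m<n⇒m<⌈n/2⌉ (subst (_< n) x≡2k (toℕ<n x)))
    toℕ-k′ : toℕ k′ ≡ k
    toℕ-k′ = toℕ-fromℕ< (m+m<n⇒m<⌈n/2⌉ (subst (_< n) x≡2k (toℕ<n x)))
    vertex≡x : evenVertex k′ ≡ x
    vertex≡x = toℕ-injective (trans (toℕ-evenVertex k′) (trans (cong₂ _+_ toℕ-k′ toℕ-k′) (sym x≡2k)))

  -- For odd n both n - 1 and 0 are even, so the wrap-around is harmless.
  matched-here-or-next : ∀ x → (x , next x) ∈ matching ⊎ (next x , next (next x)) ∈ matching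
  matched-here-or-next x with even-or-odd (toℕ x) | toℕ-next-cases x
  ... | k , inj₁ x≡2k   | _              = inj₁ (even⇒matched k x≡2k)
  ... | k , inj₂ x≡2k+1 | inj₁ nonlast   =
    inj₂ (even⇒matched (suc k) (trans nonlast (cong suc (trans x≡2k+1 (sym (+-suc k k))))))
  ... | _ , inj₂ _      | inj₂ (last , _) = inj₂ (even⇒matched 0 last)

  matching-triangleFree : TriangleFree (DeleteEdges C² matching)
  matching-triangleFree a b c (ab , bc , ac) = unmatched (triangle⇒consecutive (proj₁ ab) (proj₁ bc) (proj₁ ac))
    where
    G′ = DeleteEdges C² matching
    kept : ∀ {x y} → x ∈ a ∷ b ∷ c ∷ [] → y ∈ a ∷ b ∷ c ∷ [] → x ≢ y → G′ x y
    kept = triangle-edge G′ (deleteEdges-sym matching (square-sym cycle-sym)) ab bc ac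
    unmatched : ¬ Consecutive (a ∷ b ∷ c ∷ [])
    unmatched (i , i∈ , i+1∈ , i+2∈) with matched-here-or-next i
    ... | inj₁ matched = proj₁ (proj₂ (kept i∈ i+1∈ (x≢next-x i))) matched
    ... | inj₂ matched = proj₁ (proj₂ (kept i+1∈ i+2∈ (x≢next-x (next i)))) matched

  record Side (i : Fin n) (e : Edge n) : Set where
    constructor side
    field
      from to : ℕ
      from≤2  : from ≤ 2
      to≤2    : to ≤ 2
      from≢to : from ≢ to
      start   : proj₁ e ≡ shift from i
      end     : proj₂ e ≡ shift to i

  -- For the side joining positions s and t of the triangle {i, i+1, i+2}: zero if it passes
  -- through the apex i, suc zero for the side opposite it.
  sideClass : ℕ → ℕ → Fin 2
  sideClass zero    _       = Fin.zero
  sideClass (suc _) zero    = Fin.zero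
  sideClass (suc _) (suc _) = Fin.suc Fin.zero

  class : ∀ {i e} → Side i e → Fin 2
  class A = sideClass (Side.from A) (Side.to A)

  private
    sideClass-≤1 : ∀ {s t} → s ≢ t → s ≤ 1 → t ≤ 1 → sideClass s t ≡ Fin.zero
    sideClass-≤1 {zero}        _   _         _         = refl
    sideClass-≤1 {suc zero} {zero} _ _       _         = refl
    sideClass-≤1 {suc zero} {suc zero} s≢t _ _         = ⊥-elim (s≢t refl)
    sideClass-≤1 {suc (suc _)} _   (s≤s ()) _
    sideClass-≤1 {suc zero} {suc (suc _)} _ _ (s≤s ())

    -- Pushing a side forwards by d > 0 moves both ends off the apex, which changes the class.
    class-preserved⇒offset≡0 : ∀ d {s t} → s ≢ t → d + s ≤ 2 → d + t ≤ 2 →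
                               sideClass (d + s) (d + t) ≡ sideClass s t → d ≡ 0
    class-preserved⇒offset≡0 zero    _   _              _              _  = refl
    class-preserved⇒offset≡0 (suc d) s≢t (s≤s d+s≤1) (s≤s d+t≤1) eq
      with () ← trans eq (sideClass-≤1 s≢t (m+n≤o⇒n≤o d d+s≤1) (m+n≤o⇒n≤o d d+t≤1))

    apex-unique-≤ : ∀ {i j e} (A : Side i e) (B : Side j e) →
                    Side.from B ≤ Side.from A → class A ≡ class B → i ≡ j
    apex-unique-≤ {i} {j} (side sA tA sA≤2 tA≤2 _ startA endA) (side sB tB _ tB≤2 sB≢tB startB endB) sB≤sA class≡ =
      sym (trans j≡ (cong (λ k → shift k i) d≡0))
      where
      open ≡-Reasoning
      d = sA ∸ sB
      d+sB≡sA : d + sB ≡ sA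
      d+sB≡sA = m∸n+n≡m sB≤sA
      ahead-by-d : ∀ k → shift k (shift d i) ≡ shift (d + k) i
      ahead-by-d k = trans (shift-+ k d i) (cong (λ m → shift m i) (+-comm k d))
      j≡ : j ≡ shift d i
      j≡ = shift-injective sB (begin
        shift sB j          ≡⟨ trans (sym startB) startA ⟩
        shift sA i          ≡⟨ cong (λ k → shift k i) (sym d+sB≡sA) ⟩
        shift (d + sB) i    ≡⟨ sym (ahead-by-d sB) ⟩
        shift sB (shift d i) ∎)
      d+tB≡tA : d + tB ≡ tA
      d+tB≡tA = shift-cancel (begin
        shift (d + tB) i     ≡⟨ sym (ahead-by-d tB) ⟩
        shift tB (shift d i) ≡⟨ cong (shift tB) (sym j≡) ⟩
        shift tB j           ≡⟨ trans (sym endB) endA ⟩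
        shift tA i           ∎)
        (≤6⇒<n (≤-trans (+-mono-≤ (≤-trans (m∸n≤m sA sB) sA≤2) tB≤2) (m≤m+n 4 2)))
        (≤6⇒<n (≤-trans tA≤2 (m≤m+n 2 4)))
      d≡0 : d ≡ 0
      d≡0 = class-preserved⇒offset≡0 d sB≢tB
        (subst (_≤ 2) (sym d+sB≡sA) sA≤2) (subst (_≤ 2) (sym d+tB≡tA) tA≤2)
        (trans (cong₂ sideClass d+sB≡sA d+tB≡tA) class≡)

  apex-unique : ∀ {i j e} (A : Side i e) (B : Side j e) → class A ≡ class B → i ≡ j
  apex-unique A B class≡ with ≤-total (Side.from B) (Side.from A)
  ... | inj₁ B≤A = apex-unique-≤ A B B≤A class≡
  ... | inj₂ A≤B = sym (apex-unique-≤ B A A≤B (sym class≡))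

  Hit : List (Edge n) → Fin n → Set
  Hit F i = ∃[ e ] e ∈ F × Side i e

  module _ (F : List (Edge n)) where

    open import Data.List.Membership.DecPropositional (≡-dec (Fin._≟_ {n}) (Fin._≟_ {n})) using (_∈?_)

    Listed : Fin n → Fin n → Set
    Listed x y = (x , y) ∈ F ⊎ (y , x) ∈ F

    listed? : ∀ x y → Dec (Listed x y)
    listed? x y = ((x , y) ∈? F) ⊎-dec ((y , x) ∈? F)

    listed⇒hit : ∀ {i} s t → s ≤ 2 → t ≤ 2 → s ≢ t → Listed (shift s i) (shift t i) → Hit F i
    listed⇒hit s t s≤2 t≤2 s≢t (inj₁ st∈F) = _ , st∈F , side s t s≤2 t≤2 s≢t refl refl
    listed⇒hit s t s≤2 t≤2 s≢t (inj₂ ts∈F) = _ , ts∈F , side t s t≤2 s≤2 (≢-sym s≢t) refl refl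

    triangleFree⇒hit : TriangleFree (DeleteEdges C² F) → ∀ i → Hit F i
    triangleFree⇒hit tf i with listed? i (next i) | listed? (next i) (next (next i)) | listed? i (next (next i))
    ... | yes l₀₁ | _       | _       = listed⇒hit 0 1 z≤n (s≤s z≤n) (λ ()) l₀₁
    ... | no  _   | yes l₁₂ | _       = listed⇒hit 1 2 (s≤s z≤n) ≤-refl (λ ()) l₁₂
    ... | no  _   | no  _   | yes l₀₂ = listed⇒hit 0 2 z≤n ≤-refl (λ ()) l₀₂
    ... | no ¬l₀₁ | no ¬l₁₂ | no ¬l₀₂ =
      ⊥-elim (tf i (next i) (next (next i)) (kept (C²-next i) ¬l₀₁ , kept (C²-next (next i)) ¬l₁₂ , kept (C²-next² i) ¬l₀₂))
      where
      kept : ∀ {x y} → C² x y → ¬ Listed x y → DeleteEdges C² F x y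
      kept xy ¬l = xy , (λ xy∈F → ¬l (inj₁ xy∈F)) , (λ yx∈F → ¬l (inj₂ yx∈F))

    code : ∀ {i} → Hit F i → Fin (length F * 2)
    code (_ , e∈F , A) = combine (index e∈F) (class A)

    code-injective : ∀ {i j} (h : Hit F i) (h′ : Hit F j) → code h ≡ code h′ → i ≡ j
    code-injective (e , e∈F , A) (e′ , e′∈F , B) code≡ with combine-injective _ _ _ _ code≡
    ... | index≡ , class≡ with trans (lookup-index e∈F) (trans (cong (lookup F) index≡) (sym (lookup-index e′∈F)))
    ...   | refl = apex-unique A B class≡

    triangleFree⇒⌈n/2⌉≤length : TriangleFree (DeleteEdges C² F) → ⌈ n /2⌉ ≤ length F
    triangleFree⇒⌈n/2⌉≤length tf = n≤m+m⇒⌈n/2⌉≤m (subst (n ≤_) L*2≡L+L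
      (injective⇒≤ {f = λ i → code (triangleFree⇒hit tf i)} (code-injective (triangleFree⇒hit tf _) (triangleFree⇒hit tf _))))
      where
      L*2≡L+L : length F * 2 ≡ length F + length F
      L*2≡L+L = trans (*-comm (length F) 2) (cong (length F +_) (+-identityʳ (length F)))

lemma2 : (n : ℕ) → 7 ≤ n → PiT≡ (Square (Cycle n)) ⌈ n /2⌉
lemma2 n 7≤n =
  (matching , matching-isEdgeSet , length-tabulate matchingEdge , matching-triangleFree) ,
  (λ F _ → triangleFree⇒⌈n/2⌉≤length F)
  where open SquareOfCycle n 7≤n
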